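{- (a) For all integers $t\ge1$ and $0\le i\le\frac{t-1}{2}$: $\sum_{0\le j\le i} d_j(t-i+j)=d''_i(t+1)$. (b) For all integers $t\ge 0$ and $0\le i\le t$: $\sum_{0\le j\le i} d'_j(t-i+j)=d_i(t)$.
   Context: Even-index numbers: for integers $t\ge 0$ and $0\le i\le t/2$ define $d_i(t)$ recursively by $d_0(t)=1$ for all $t\ge0$; for $i\ge1$ and $2i<t$: $d_i(t)=2d_{i-1}(t-1)+d_i(t-1)-d_{i-1}(t-2)$; for $i\ge 1$: $d_i(2i)=3d_{i-1}(2i-1)-d_{i-1}(2i-2)$. Extend to all $i\in\mathbb Z$ by $d_i(t)=0$ for $i<0$ and $d_i(t)=d_{t-i}(t)$ for $i>t/2$. Odd-index numbers: let $V$ be the set of pairs $(i,t)$ of integers with either $(i,t)=(0,0)$ or $0\le i\le t-1$. Define $d'_i(t)$ for $(i,t)\in V$ by: $d'_0(t)=1$ for all $t\ge 0$; $d'_{t-1}(t)=1$ for all $t\ge 3$; for all other $(i,t)\in V$ (i.e. $1\le i\le t-2$, or $(i,t)=(1,2)$), recursively in $t$: if $2i\le t$ then $d'_i(t)=2d'_{i-1}(t-1)+d'_i(t-1)-d'_{i-1}(t-2)$, and if $2i\ge t+1$ then $d'_i(t)=d'_{i-1}(t-1)+2d'_i(t-1)-d'_{i-1}(t-2)$. Set $d'_i(t)=0$ for $(i,t)\notin V$ (with $t\ge 0$), and define $d''_i(t)=d'_{t-1-i}(t)$ for all $i\in\mathbb Z$, $t\ge0$. -}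

module Defs where

open import Data.Nat using (ℕ; zero; suc; _∸_; _<ᵇ_; _≤ᵇ_; _≡ᵇ_) renaming (_*_ to _*ℕ_)
open import Data.Bool using (if_then_else_; not; _∧_)
open import Data.Integer using (ℤ; +_; -[1+_]; _+_; _-_; _*_; 1ℤ; 0ℤ)

-- Core even-index numbers d_i(t), meaningful for 0 ≤ i ≤ t/2
-- (values outside that range are never used; set to 0).
dCore : ℕ → ℕ → ℤ
dCore zero t = 1ℤ
dCore (suc i) zero = 0ℤ
dCore (suc i) (suc zero) = 0ℤ
-- here the paper's t is t+2 and the paper's i is i+1:
-- 2(i+1) < t+2  ⇔  2i < t ;   2(i+1) = t+2  ⇔  2i = t
dCore (suc i) (suc (suc t)) =
  if (2 *ℕ i) <ᵇ t
  then + 2 * dCore i (suc t) + dCore (suc i) (suc t) - dCore i t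
  else (if (2 *ℕ i) ≡ᵇ t
        then + 3 * dCore i (suc t) - dCore i t
        else 0ℤ)

dNat : ℕ → ℕ → ℤ
dNat i t =
  if (2 *ℕ i) ≤ᵇ t then dCore i t
  else (if i ≤ᵇ t then dCore (t ∸ i) t else 0ℤ)

d : ℤ → ℕ → ℤ
d (+ i) t = dNat i t
d -[1+ _ ] t = 0ℤ

-- Odd-index numbers d'_i(t) for naturals i, with value 0 outside
-- V = {(0,0)} ∪ {(i,t) : 0 ≤ i ≤ t-1}.
d'Nat : ℕ → ℕ → ℤ
d'Nat zero t = 1ℤ
d'Nat (suc i) zero = 0ℤ
d'Nat (suc i) (suc zero) = 0ℤ
-- paper's t is t+2, paper's i is i+1; (i+1,t+2) ∈ V ⇔ i ≤ t.
-- i+1 = (t+2)-1 with t+2 ≥ 3 (⇔ i ≡ t and 1 ≤ t): value 1.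
-- all other cases (1 ≤ i+1 ≤ (t+2)-2, or (i+1,t+2) = (1,2)): recursion,
-- where 2(i+1) ≤ t+2 ⇔ 2i ≤ t.
d'Nat (suc i) (suc (suc t)) =
  if not (i ≤ᵇ t) then 0ℤ
  else (if (i ≡ᵇ t) ∧ (1 ≤ᵇ t) then 1ℤ
  else (if (2 *ℕ i) ≤ᵇ t
        then + 2 * d'Nat i (suc t) + d'Nat (suc i) (suc t) - d'Nat i t
        else d'Nat i (suc t) + + 2 * d'Nat (suc i) (suc t) - d'Nat i t))

d' : ℤ → ℕ → ℤ
d' (+ i) t = d'Nat i t
d' -[1+ _ ] t = 0ℤ

d'' : ℤ → ℕ → ℤ
d'' i t = d' ((+ t - 1ℤ) - i) t

sumBelow : ℕ → (ℕ → ℤ) → ℤ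
sumBelow zero f = 0ℤ
sumBelow (suc n) f = sumBelow n f + f n

module Submission where

-- Both identities are consequences of one structural fact relating the
-- two families of numbers:
--
--     d'_i(t) = d_i(t) − d_{i−1}(t−1)      for 0 ≤ i ≤ t  (d_{−1} = 0).   (★)
--
-- The definition of d only gives the recursion on the lower half of each
-- row (2i ≤ t).  Using the mirror symmetry d_i(t) = d_{t−i}(t) we obtain a
-- "high" recursion, with the coefficients 1 and 2 exchanged, on the upper
-- half.  Both recursions are linear, hence they pass to the difference
-- d_i(t) − d_{i−1}(t−1); as d' satisfies the same recursions and has the
-- same boundary values, (★) follows by induction on t.
-- Part (b) is then a telescoping sum of (★) along a diagonal.  Part (a) is
-- telescoping as well: by the low recursion, d_j(s+j) is the increment of
-- G_j = d_j(s+j) − d_j(s+j−1), and the resulting value G_{i+1} equals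
-- d''_i(t+1) = d'_{t−i}(t+1) by (★) and the mirror symmetry.

open import Defs
open import Data.Nat using (ℕ; zero; suc; _+_; _∸_; _*_; _≤_; _<_; z≤n; s≤s; s≤s⁻¹; _≡ᵇ_; _≤?_)
open import Data.Nat.Properties
open import Data.Integer using (ℤ; +_; 1ℤ; 0ℤ) renaming (_+_ to _+ℤ_; _-_ to _-ℤ_; _*_ to _*ℤ_)
import Data.Integer.Properties as ℤP
open import Data.Integer.Tactic.RingSolver using (solve-∀)
open import Data.Bool using (true; false)
open import Data.Product using (_×_; _,_)
open import Data.Sum using (inj₁; inj₂)
open import Relation.Nullary using (¬_; Dec; yes; no)
open import Relation.Nullary.Reflects using (Reflects; of; det; fromEquivalence)
open import Relation.Binary.PropositionalEquality

reflects-true : ∀ {P : Set} {b} → Reflects P b → P → b ≡ true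
reflects-true r p = det r (of p)

reflects-false : ∀ {P : Set} {b} → Reflects P b → ¬ P → b ≡ false
reflects-false r ¬p = det r (of ¬p)

≡ᵇ-reflects-≡ : ∀ m n → Reflects (m ≡ n) (m ≡ᵇ n)
≡ᵇ-reflects-≡ m n = fromEquivalence (≡ᵇ⇒≡ m n) (≡⇒≡ᵇ m n)

double≤sum⇒≤ : ∀ i j → 2 * i ≤ i + j → i ≤ j
double≤sum⇒≤ i j h = subst (_≤ j) (+-identityʳ i) (+-cancelˡ-≤ i (i + 0) j h)

≤⇒double≤sum : ∀ i j → i ≤ j → 2 * i ≤ i + j
≤⇒double≤sum i j h = +-monoʳ-≤ i (subst (_≤ j) (sym (+-identityʳ i)) h)

double-suc-< : ∀ i {t} → 2 * i < t → 2 * suc i ≤ suc t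
double-suc-< i {t} h = subst (_≤ suc t) (sym (*-suc 2 i)) (s≤s h)

double-suc-≤ : ∀ i {t} → 2 * i ≤ t → 2 * suc i ≤ suc (suc t)
double-suc-≤ i h = double-suc-< i (s≤s h)

dNat-low : ∀ i {t} → 2 * i ≤ t → dNat i t ≡ dCore i t
dNat-low i {t} h rewrite reflects-true (≤ᵇ-reflects-≤ (2 * i) t) h = refl

dNat-high : ∀ {i t} → ¬ 2 * i ≤ t → i ≤ t → dNat i t ≡ dCore (t ∸ i) t
dNat-high {i} {t} h i≤t
  rewrite reflects-false (≤ᵇ-reflects-≤ (2 * i) t) h
        | reflects-true (≤ᵇ-reflects-≤ i t) i≤t = refl

dNat-mirror-low : ∀ i j → i ≤ j → dNat j (i + j) ≡ dNat i (i + j)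
dNat-mirror-low i j i≤j with 2 * j ≤? i + j
... | yes h with ≤-antisym i≤j (double≤sum⇒≤ j i (subst (2 * j ≤_) (+-comm i j) h))
...   | refl = refl
dNat-mirror-low i j i≤j | no h = begin
  dNat j (i + j)              ≡⟨ dNat-high h (m≤n+m j i) ⟩
  dCore (i + j ∸ j) (i + j)   ≡⟨ cong (λ k → dCore k (i + j)) (m+n∸n≡m i j) ⟩
  dCore i (i + j)             ≡⟨ dNat-low i (≤⇒double≤sum i j i≤j) ⟨
  dNat i (i + j)              ∎
  where open ≡-Reasoning

dNat-sym : ∀ i j {t} → i + j ≡ t → dNat i t ≡ dNat j t
dNat-sym i j refl with ≤-total i j
... | inj₁ i≤j = sym (dNat-mirror-low i j i≤j)
... | inj₂ j≤i = subst (λ t → dNat i t ≡ dNat j t) (+-comm j i) (dNat-mirror-low j i j≤i)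

dNat-diag : ∀ n → dNat n n ≡ 1ℤ
dNat-diag n = dNat-sym n 0 (+-identityʳ n)

LowRec : (ℕ → ℕ → ℤ) → ℕ → ℕ → Set
LowRec f i t = f (suc i) (suc (suc t)) ≡ + 2 *ℤ f i (suc t) +ℤ f (suc i) (suc t) -ℤ f i t

HighRec : (ℕ → ℕ → ℤ) → ℕ → ℕ → Set
HighRec f i t = f (suc i) (suc (suc t)) ≡ f i (suc t) +ℤ + 2 *ℤ f (suc i) (suc t) -ℤ f i t

lowSum-cong : ∀ {a a′ b b′ c c′ : ℤ} → a ≡ a′ → b ≡ b′ → c ≡ c′ →
  + 2 *ℤ a +ℤ b -ℤ c ≡ + 2 *ℤ a′ +ℤ b′ -ℤ c′
lowSum-cong refl refl refl = refl

highSum-cong : ∀ {a a′ b b′ c c′ : ℤ} → a ≡ a′ → b ≡ b′ → c ≡ c′ →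
  a +ℤ + 2 *ℤ b -ℤ c ≡ a′ +ℤ + 2 *ℤ b′ -ℤ c′
highSum-cong refl refl refl = refl

LowRec-sub : ∀ {f g i t} → LowRec f i t → LowRec g i t → LowRec (λ i t → f i t -ℤ g i t) i t
LowRec-sub {f} {g} {i} {t} rf rg = trans (cong₂ _-ℤ_ rf rg)
  (linear (f i (suc t)) (f (suc i) (suc t)) (f i t) (g i (suc t)) (g (suc i) (suc t)) (g i t))
  where
  linear : ∀ a b c a′ b′ c′ → (+ 2 *ℤ a +ℤ b -ℤ c) -ℤ (+ 2 *ℤ a′ +ℤ b′ -ℤ c′)
                               ≡ + 2 *ℤ (a -ℤ a′) +ℤ (b -ℤ b′) -ℤ (c -ℤ c′)
  linear = solve-∀

HighRec-sub : ∀ {f g i t} → HighRec f i t → HighRec g i t → HighRec (λ i t → f i t -ℤ g i t) i t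
HighRec-sub {f} {g} {i} {t} rf rg = trans (cong₂ _-ℤ_ rf rg)
  (linear (f i (suc t)) (f (suc i) (suc t)) (f i t) (g i (suc t)) (g (suc i) (suc t)) (g i t))
  where
  linear : ∀ a b c a′ b′ c′ → (a +ℤ + 2 *ℤ b -ℤ c) -ℤ (a′ +ℤ + 2 *ℤ b′ -ℤ c′)
                               ≡ (a -ℤ a′) +ℤ + 2 *ℤ (b -ℤ b′) -ℤ (c -ℤ c′)
  linear = solve-∀

LowRec-determined : ∀ {f g i t} → LowRec f i t → LowRec g i t →
  f i (suc t) ≡ g i (suc t) → f (suc i) (suc t) ≡ g (suc i) (suc t) → f i t ≡ g i t →
  f (suc i) (suc (suc t)) ≡ g (suc i) (suc (suc t))
LowRec-determined rf rg a b c =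
  trans rf (trans (lowSum-cong a b c) (sym rg))

HighRec-determined : ∀ {f g i t} → HighRec f i t → HighRec g i t →
  f i (suc t) ≡ g i (suc t) → f (suc i) (suc t) ≡ g (suc i) (suc t) → f i t ≡ g i t →
  f (suc i) (suc (suc t)) ≡ g (suc i) (suc (suc t))
HighRec-determined rf rg a b c =
  trans rf (trans (highSum-cong a b c) (sym rg))

dCore-inner : ∀ i {t} → 2 * i < t →
  dCore (suc i) (suc (suc t)) ≡ + 2 *ℤ dCore i (suc t) +ℤ dCore (suc i) (suc t) -ℤ dCore i t
dCore-inner i {t} h rewrite reflects-true (<ᵇ-reflects-< (2 * i) t) h = refl

dCore-middle : ∀ i {t} → 2 * i ≡ t → dCore (suc i) (suc (suc t)) ≡ + 3 *ℤ dCore i (suc t) -ℤ dCore i t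
dCore-middle i {t} h
  rewrite reflects-false (<ᵇ-reflects-< (2 * i) t) (<-irrefl h)
        | reflects-true (≡ᵇ-reflects-≡ (2 * i) t) h = refl

-- The defining recursion of d, extended to the middle of the row by symmetry.
dNat-lowRec : ∀ i {t} → 2 * i ≤ t → LowRec dNat i t
dNat-lowRec i {t} h with m≤n⇒m<n∨m≡n h
... | inj₁ 2i<t = begin
  dNat (suc i) (suc (suc t))    ≡⟨ dNat-low (suc i) (double-suc-≤ i h) ⟩
  dCore (suc i) (suc (suc t))   ≡⟨ dCore-inner i 2i<t ⟩
  + 2 *ℤ dCore i (suc t) +ℤ dCore (suc i) (suc t) -ℤ dCore i t
    ≡⟨ lowSum-cong (dNat-low i (m≤n⇒m≤1+n h)) (dNat-low (suc i) (double-suc-< i 2i<t)) (dNat-low i h) ⟨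
  + 2 *ℤ dNat i (suc t) +ℤ dNat (suc i) (suc t) -ℤ dNat i t ∎
  where open ≡-Reasoning
... | inj₂ 2i≡t = begin
  dNat (suc i) (suc (suc t))    ≡⟨ dNat-low (suc i) (double-suc-≤ i h) ⟩
  dCore (suc i) (suc (suc t))   ≡⟨ dCore-middle i 2i≡t ⟩
  + 3 *ℤ dCore i (suc t) -ℤ dCore i t                            ≡⟨ split (dCore i (suc t)) (dCore i t) ⟩
  + 2 *ℤ dCore i (suc t) +ℤ dCore i (suc t) -ℤ dCore i t
    ≡⟨ lowSum-cong (dNat-low i (m≤n⇒m≤1+n h)) (trans (dNat-sym (suc i) i i+1+i≡t+1) (dNat-low i (m≤n⇒m≤1+n h)))
                   (dNat-low i h) ⟨
  + 2 *ℤ dNat i (suc t) +ℤ dNat (suc i) (suc t) -ℤ dNat i t ∎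
  where
  open ≡-Reasoning
  i+1+i≡t+1 : suc i + i ≡ suc t
  i+1+i≡t+1 = cong suc (trans (cong (λ x → i + x) (sym (+-identityʳ i))) 2i≡t)
  split : ∀ a b → + 3 *ℤ a -ℤ b ≡ + 2 *ℤ a +ℤ a -ℤ b
  split = solve-∀

-- The high recursion at (i+1, t+2) is the low recursion at the mirror point.
dNat-highRec-mirror : ∀ {i k} → k ≤ i → HighRec dNat i (i + k)
dNat-highRec-mirror {i} {k} k≤i = begin
  dNat (suc i) (suc (suc (i + k)))  ≡⟨ dNat-sym (suc i) (suc k) (cong suc (+-suc i k)) ⟩
  dNat (suc k) (suc (suc (i + k)))  ≡⟨ dNat-lowRec k 2k≤i+k ⟩
  + 2 *ℤ dNat k (suc (i + k)) +ℤ dNat (suc k) (suc (i + k)) -ℤ dNat k (i + k)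
    ≡⟨ lowSum-cong (dNat-sym k (suc i) (trans (+-suc k i) (cong suc k+i≡i+k)))
                   (dNat-sym (suc k) i (cong suc k+i≡i+k)) (dNat-sym k i k+i≡i+k) ⟩
  + 2 *ℤ dNat (suc i) (suc (i + k)) +ℤ dNat i (suc (i + k)) -ℤ dNat i (i + k)
    ≡⟨ swap (dNat (suc i) (suc (i + k))) (dNat i (suc (i + k))) (dNat i (i + k)) ⟩
  dNat i (suc (i + k)) +ℤ + 2 *ℤ dNat (suc i) (suc (i + k)) -ℤ dNat i (i + k) ∎
  where
  open ≡-Reasoning
  k+i≡i+k = +-comm k i
  2k≤i+k = subst (2 * k ≤_) k+i≡i+k (≤⇒double≤sum k i k≤i)
  swap : ∀ a b c → + 2 *ℤ a +ℤ b -ℤ c ≡ b +ℤ + 2 *ℤ a -ℤ c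
  swap = solve-∀

dNat-highRec : ∀ {i t} → t ≤ 2 * i → i ≤ t → HighRec dNat i t
dNat-highRec {i} h i≤t with m≤n⇒∃[o]m+o≡n i≤t
... | k , refl = dNat-highRec-mirror (subst (_ ≤_) (+-identityʳ i) (+-cancelˡ-≤ i _ _ h))

dShift : ℕ → ℕ → ℤ
dShift zero    _       = 0ℤ
dShift (suc i) zero    = 0ℤ
dShift (suc i) (suc t) = dNat i t

dShift-lowRec : ∀ i {t} → 2 * i ≤ t → LowRec dShift i t
dShift-lowRec zero          _ = refl
dShift-lowRec (suc i) {zero}  ()
dShift-lowRec (suc i) {suc t} h =
  dNat-lowRec i (<⇒≤ (s≤s⁻¹ (subst (_≤ suc t) (*-suc 2 i) h)))

dShift-highRec : ∀ {i t} → t < 2 * i → i ≤ t → HighRec dShift i t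
dShift-highRec {zero}          ()
dShift-highRec {suc i} {zero}  _ ()
dShift-highRec {suc i} {suc t} h (s≤s i≤t) =
  dNat-highRec (s≤s⁻¹ (s≤s⁻¹ (subst (suc (suc t) ≤_) (*-suc 2 i) h))) i≤t

-- The right-hand side of (★): dDiff i t = d_i(t) − d_{i−1}(t−1).
dDiff : ℕ → ℕ → ℤ
dDiff i t = dNat i t -ℤ dShift i t

dDiff-lowRec : ∀ i {t} → 2 * i ≤ t → LowRec dDiff i t
dDiff-lowRec i {t} h = LowRec-sub {dNat} {dShift} {i} {t} (dNat-lowRec i h) (dShift-lowRec i h)

dDiff-highRec : ∀ {i t} → t < 2 * i → i ≤ t → HighRec dDiff i t
dDiff-highRec {i} {t} h i≤t = HighRec-sub {dNat} {dShift} {i} {t} (dNat-highRec (<⇒≤ h) i≤t) (dShift-highRec h i≤t)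

dDiff-beyond : ∀ t → dDiff (suc (suc t)) (suc (suc t)) ≡ 0ℤ
dDiff-beyond t rewrite dNat-diag (suc (suc t)) | dNat-diag (suc t) = refl

dDiff-corner : ∀ t → dDiff (suc t) (suc (suc t)) ≡ 1ℤ
dDiff-corner t = begin
  dNat (suc t) (suc (suc t)) -ℤ dNat t (suc t)
    ≡⟨ cong₂ _-ℤ_ (dNat-sym (suc t) 1 (+-comm (suc t) 1)) (dNat-sym t 1 (+-comm t 1)) ⟩
  dNat 1 (suc (suc t)) -ℤ dNat 1 (suc t)
    ≡⟨ cong (_-ℤ dNat 1 (suc t)) (dNat-lowRec 0 {t} z≤n) ⟩
  + 2 *ℤ 1ℤ +ℤ dNat 1 (suc t) -ℤ 1ℤ -ℤ dNat 1 (suc t)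
    ≡⟨ cancel (dNat 1 (suc t)) ⟩
  1ℤ ∎
  where
  open ≡-Reasoning
  cancel : ∀ x → + 2 *ℤ 1ℤ +ℤ x -ℤ 1ℤ -ℤ x ≡ 1ℤ
  cancel = solve-∀

d'-beyond : ∀ t → d'Nat (suc (suc t)) (suc (suc t)) ≡ 0ℤ
d'-beyond t rewrite reflects-false (≤ᵇ-reflects-≤ (suc t) t) (<-irrefl refl) = refl

d'-corner : ∀ t → d'Nat (suc t) (suc (suc t)) ≡ 1ℤ
d'-corner zero = refl
d'-corner (suc t)
  rewrite reflects-true (≤ᵇ-reflects-≤ (suc t) (suc t)) ≤-refl
        | reflects-true (≡ᵇ-reflects-≡ t t) refl = refl

d'-lowRec : ∀ {i t} → i < t → 2 * i ≤ t → LowRec d'Nat i t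
d'-lowRec {i} {t} i<t h
  rewrite reflects-true (≤ᵇ-reflects-≤ i t) (<⇒≤ i<t)
        | reflects-false (≡ᵇ-reflects-≡ i t) (<⇒≢ i<t)
        | reflects-true (≤ᵇ-reflects-≤ (2 * i) t) h = refl

d'-highRec : ∀ {i t} → i < t → ¬ 2 * i ≤ t → HighRec d'Nat i t
d'-highRec {i} {t} i<t h
  rewrite reflects-true (≤ᵇ-reflects-≤ i t) (<⇒≤ i<t)
        | reflects-false (≡ᵇ-reflects-≡ i t) (<⇒≢ i<t)
        | reflects-false (≤ᵇ-reflects-≤ (2 * i) t) h = refl

d'≡dDiff-interior : ∀ {i t} → i < t →
  (∀ j → j ≤ suc t → d'Nat j (suc t) ≡ dDiff j (suc t)) →
  (∀ j → j ≤ t → d'Nat j t ≡ dDiff j t) →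
  d'Nat (suc i) (suc (suc t)) ≡ dDiff (suc i) (suc (suc t))
d'≡dDiff-interior {i} {t} i<t row₁ row₀ = byHalf (2 * i ≤? t)
  where
  i≤t = <⇒≤ i<t
  row₁-i = row₁ i (m≤n⇒m≤1+n i≤t)
  row₁-i+1 = row₁ (suc i) (m≤n⇒m≤1+n i<t)
  row₀-i = row₀ i i≤t
  byHalf : Dec (2 * i ≤ t) → d'Nat (suc i) (suc (suc t)) ≡ dDiff (suc i) (suc (suc t))
  byHalf (yes h) = LowRec-determined {d'Nat} {dDiff} {i} {t} (d'-lowRec i<t h) (dDiff-lowRec i h)
                     row₁-i row₁-i+1 row₀-i
  byHalf (no h) = HighRec-determined {d'Nat} {dDiff} {i} {t} (d'-highRec i<t h) (dDiff-highRec (≰⇒> h) i≤t)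
                    row₁-i row₁-i+1 row₀-i

-- (★) on row t+2 (at indices ≥ 1) from (★) on rows t+1 and t: the last two
-- entries are boundary values, the others are interior.
d'≡dDiff-nextRow : ∀ t i → i ≤ suc t →
  (∀ j → j ≤ suc t → d'Nat j (suc t) ≡ dDiff j (suc t)) →
  (∀ j → j ≤ t → d'Nat j t ≡ dDiff j t) →
  d'Nat (suc i) (suc (suc t)) ≡ dDiff (suc i) (suc (suc t))
d'≡dDiff-nextRow t i i≤t+1 row₁ row₀ with m≤n⇒m<n∨m≡n i≤t+1
... | inj₂ refl = trans (d'-beyond t) (sym (dDiff-beyond t))
... | inj₁ (s≤s i≤t) with m≤n⇒m<n∨m≡n i≤t
...   | inj₂ refl = trans (d'-corner t) (sym (dDiff-corner t))
...   | inj₁ i<t  = d'≡dDiff-interior i<t row₁ row₀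

d'≡dDiff : ∀ t i → i ≤ t → d'Nat i t ≡ dDiff i t
d'≡dDiff t             zero          _ = refl
d'≡dDiff zero          (suc i)       ()
d'≡dDiff (suc zero)    (suc zero)    _ = refl
d'≡dDiff (suc zero)    (suc (suc i)) (s≤s ())
d'≡dDiff (suc (suc t)) (suc i)       (s≤s i≤t+1) =
  d'≡dDiff-nextRow t i i≤t+1 (d'≡dDiff (suc t)) (d'≡dDiff t)

sumBelow-cong : ∀ n {f g : ℕ → ℤ} → (∀ j → j < n → f j ≡ g j) → sumBelow n f ≡ sumBelow n g
sumBelow-cong zero    _  = refl
sumBelow-cong (suc n) eq =
  cong₂ _+ℤ_ (sumBelow-cong n (λ j j<n → eq j (m≤n⇒m≤1+n j<n))) (eq n ≤-refl)

telescope : ∀ (g : ℕ → ℤ) n → sumBelow n (λ j → g (suc j) -ℤ g j) ≡ g n -ℤ g 0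
telescope g zero    = sym (ℤP.+-inverseʳ (g 0))
telescope g (suc n) = trans (cong (_+ℤ (g (suc n) -ℤ g n)) (telescope g n)) (collapse (g 0) (g n) (g (suc n)))
  where
  collapse : ∀ a b c → (b -ℤ a) +ℤ (c -ℤ b) ≡ c -ℤ a
  collapse = solve-∀

-- Part (b) along the diagonal starting at (0, s): a telescoping sum of (★).
diagonal-sum-d' : ∀ s i → sumBelow (suc i) (λ j → d'Nat j (s + j)) ≡ dNat i (s + i)
diagonal-sum-d' s i = begin
  sumBelow (suc i) (λ j → d'Nat j (s + j))
    ≡⟨ sumBelow-cong (suc i) (λ j _ → trans (d'≡dDiff (s + j) j (m≤n+m j s)) (increment j)) ⟩
  sumBelow (suc i) (λ j → g (suc j) -ℤ g j)   ≡⟨ telescope g (suc i) ⟩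
  dNat i (s + i) -ℤ 0ℤ                       ≡⟨ ℤP.+-identityʳ _ ⟩
  dNat i (s + i)                             ∎
  where
  open ≡-Reasoning
  g : ℕ → ℤ
  g zero    = 0ℤ
  g (suc j) = dNat j (s + j)
  increment : ∀ j → dDiff j (s + j) ≡ g (suc j) -ℤ g j
  increment zero    = refl
  increment (suc j) = cong (λ u → dNat (suc j) (s + suc j) -ℤ dShift (suc j) u) (+-suc s j)

partB : (t i : ℕ) → i ≤ t → sumBelow (suc i) (λ j → d' (+ j) ((t ∸ i) + j)) ≡ d (+ i) t
partB t i i≤t = trans (diagonal-sum-d' (t ∸ i) i) (cong (dNat i) (m∸n+n≡m i≤t))

-- Part (a) along the diagonal starting at (0, n+1), for i ≤ n: by the low
-- recursion, d_j(n+1+j) is the increment of G_j = d_j(n+1+j) − d_j(n+j).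
diagonal-sum-d : ∀ n i → i ≤ n → sumBelow (suc i) (λ j → dNat j (suc n + j))
                   ≡ dNat (suc i) (suc (suc (n + i))) -ℤ dNat (suc i) (suc (n + i))
diagonal-sum-d n i i≤n = begin
  sumBelow (suc i) (λ j → dNat j (suc n + j))
    ≡⟨ sumBelow-cong (suc i) (λ j j≤i → increment j (≤-trans (s≤s⁻¹ j≤i) i≤n)) ⟩
  sumBelow (suc i) (λ j → G (suc j) -ℤ G j)   ≡⟨ telescope G (suc i) ⟩
  G (suc i) -ℤ 0ℤ                             ≡⟨ ℤP.+-identityʳ _ ⟩
  G (suc i)                                   ≡⟨ cong (λ u → dNat (suc i) (suc u) -ℤ dNat (suc i) u) (+-suc n i) ⟩
  dNat (suc i) (suc (suc (n + i))) -ℤ dNat (suc i) (suc (n + i)) ∎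
  where
  open ≡-Reasoning
  G : ℕ → ℤ
  G j = dNat j (suc (n + j)) -ℤ dNat j (n + j)
  peel : ∀ a b c → a ≡ (+ 2 *ℤ a +ℤ b -ℤ c -ℤ b) -ℤ (a -ℤ c)
  peel = solve-∀
  increment : ∀ j → j ≤ n → dNat j (suc n + j) ≡ G (suc j) -ℤ G j
  increment j j≤n = begin
    dNat j (suc (n + j))
      ≡⟨ peel (dNat j (suc (n + j))) (dNat (suc j) (suc (n + j))) (dNat j (n + j)) ⟩
    (+ 2 *ℤ dNat j (suc (n + j)) +ℤ dNat (suc j) (suc (n + j)) -ℤ dNat j (n + j)
       -ℤ dNat (suc j) (suc (n + j))) -ℤ G j
      ≡⟨ cong (λ x → (x -ℤ dNat (suc j) (suc (n + j))) -ℤ G j)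
              (dNat-lowRec j (subst (2 * j ≤_) (+-comm j n) (≤⇒double≤sum j n j≤n))) ⟨
    (dNat (suc j) (suc (suc (n + j))) -ℤ dNat (suc j) (suc (n + j))) -ℤ G j
      ≡⟨ cong (λ u → (dNat (suc j) (suc u) -ℤ dNat (suc j) u) -ℤ G j) (+-suc n j) ⟨
    G (suc j) -ℤ G j ∎

-- d''_i(n+i+2) = d'_{n+1}(n+i+2) = d_{n+1}(n+i+2) − d_n(n+i+1), mirrored.
d''-diagonal : ∀ n i → d'' (+ i) (suc (suc (n + i)))
                 ≡ dNat (suc i) (suc (suc (n + i))) -ℤ dNat (suc i) (suc (n + i))
d''-diagonal n i = begin
  d'' (+ i) (suc (suc (n + i)))
    ≡⟨ cong (λ z → d' z (suc (suc (n + i)))) index ⟩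
  d'Nat (suc n) (suc (suc (n + i)))
    ≡⟨ d'≡dDiff (suc (suc (n + i))) (suc n) (s≤s (m≤n⇒m≤1+n (m≤m+n n i))) ⟩
  dNat (suc n) (suc (suc (n + i))) -ℤ dNat n (suc (n + i))
    ≡⟨ cong₂ _-ℤ_ (dNat-sym (suc n) (suc i) (cong suc (+-suc n i))) (dNat-sym n (suc i) (+-suc n i)) ⟩
  dNat (suc i) (suc (suc (n + i))) -ℤ dNat (suc i) (suc (n + i)) ∎
  where
  open ≡-Reasoning
  cancel : ∀ a b → (a +ℤ b) -ℤ b ≡ a
  cancel = solve-∀
  index : (+ suc (suc (n + i)) -ℤ 1ℤ) -ℤ + i ≡ + suc n
  index = trans (cong (_-ℤ + i) (ℤP.pos-+ (suc n) i)) (cancel (+ suc n) (+ i))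

partA : (t i : ℕ) → 1 ≤ t → 2 * i ≤ t ∸ 1 →
  sumBelow (suc i) (λ j → d (+ j) ((t ∸ i) + j)) ≡ d'' (+ i) (suc t)
partA (suc t) i _ h = begin
  sumBelow (suc i) (λ j → dNat j ((suc t ∸ i) + j))
    ≡⟨ cong (λ s → sumBelow (suc i) (λ j → dNat j (s + j))) (+-∸-assoc 1 i≤t) ⟩
  sumBelow (suc i) (λ j → dNat j (suc n + j))                      ≡⟨ diagonal-sum-d n i i≤n ⟩
  dNat (suc i) (suc (suc (n + i))) -ℤ dNat (suc i) (suc (n + i))    ≡⟨ d''-diagonal n i ⟨
  d'' (+ i) (suc (suc (n + i)))                                     ≡⟨ cong (λ u → d'' (+ i) (suc (suc u))) (m∸n+n≡m i≤t) ⟩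
  d'' (+ i) (suc (suc t))                                           ∎
  where
  open ≡-Reasoning
  n = t ∸ i
  i≤t : i ≤ t
  i≤t = ≤-trans (m≤m+n i (i + 0)) h
  i≤n : i ≤ n
  i≤n = m+n≤o⇒m≤o∸n i (subst (_≤ t) (cong (λ x → i + x) (+-identityʳ i)) h)

corollary4 :
    ((t i : ℕ) → 1 ≤ t → 2 * i ≤ t ∸ 1 →
      sumBelow (suc i) (λ j → d (+ j) ((t ∸ i) + j)) ≡ d'' (+ i) (suc t))
    ×
    ((t i : ℕ) → i ≤ t →
      sumBelow (suc i) (λ j → d' (+ j) ((t ∸ i) + j)) ≡ d (+ i) t)
corollary4 = partA , partB
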